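{- Let $n\ge 3$ be odd and $m>1$ be odd, and let $G$ be a non-regular bipartite graph of order $m$ in which all vertices of each partite set have the same degree. Then $\chi_{ld}(G[\overline{K_n}])=2$.
   Context: For a graph $G=(V,E)$ of order $N$ and a bijection $f\colon V\to\{1,\dots,N\}$, the weight of a vertex $u$ is $w(u)=\sum_{x\in N(u)}f(x)$, where $N(u)$ is the open neighborhood of $u$. The bijection $f$ is a local distance antimagic labeling if $w(u)\neq w(v)$ for every edge $uv$. $\chi_{ld}(G)$ is the minimum number of distinct weights over all local distance antimagic labelings of $G$. $\overline{K_n}$ is the edgeless graph on $n$ vertices. The lexicographic product $G[H]$ has vertex set $V(G)\times V(H)$, with $(g,h)$ adjacent to $(g',h')$ iff $gg'\in E(G)$, or $g=g'$ and $hh'\in E(H)$. -}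

module Defs where

open import Data.Nat using (ℕ; zero; suc; _+_; _*_; _≤_; _%_)
import Data.Nat.Properties as ℕP
open import Data.Fin using (Fin; toℕ; remQuot)
import Data.Fin.Properties as FinP
open import Data.Fin.Permutation using (Permutation′; _⟨$⟩ʳ_)
open import Data.Bool using (Bool; true; false; if_then_else_; _∨_; _∧_; T?)
open import Data.List using (List; length; map; filter; deduplicate; allFin)
open import Data.Nat.ListAction using (sum)
open import Data.Product using (Σ; ∃; _×_; _,_)
open import Relation.Binary.PropositionalEquality using (_≡_; _≢_; refl)
open import Relation.Nullary.Decidable using (⌊_⌋)

record Graph (N : ℕ) : Set where
  field
    adj    : Fin N → Fin N → Bool
    sym    : ∀ u v → adj u v ≡ adj v u
    irrefl : ∀ u → adj u u ≡ false
open Graph public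

deg : ∀ {N} → Graph N → Fin N → ℕ
deg {N} G u = length (filter (λ v → T? (adj G u v)) (allFin N))

emptyGraph : (n : ℕ) → Graph n
emptyGraph n = record { adj = λ _ _ → false ; sym = λ _ _ → refl ; irrefl = λ _ → refl }

-- Adjacency of the lexicographic product G[H]; the vertex (g,h) of
-- V(G) × V(H) is encoded as the element of Fin (m * n) that remQuot
-- decodes to (g , h) (i.e. combine g h).
lexAdj : ∀ {m n} → Graph m → Graph n → Fin (m * n) → Fin (m * n) → Bool
lexAdj {m} {n} G H x y with remQuot {m} n x | remQuot {m} n y
... | (g , h) | (g' , h') = adj G g g' ∨ (⌊ g FinP.≟ g' ⌋ ∧ adj H h h')

Adj : ℕ → Set
Adj N = Fin N → Fin N → Bool

-- A labeling is a bijection V → {1,…,N}: a permutation of Fin N, shifted by 1.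
Labeling : ℕ → Set
Labeling N = Permutation′ N

label : ∀ {N} → Labeling N → Fin N → ℕ
label f v = suc (toℕ (f ⟨$⟩ʳ v))

weight : ∀ {N} → Adj N → Labeling N → Fin N → ℕ
weight {N} A f u = sum (map (λ x → if A u x then label f x else 0) (allFin N))

IsLDAL : ∀ {N} → Adj N → Labeling N → Set
IsLDAL {N} A f = ∀ u v → A u v ≡ true → weight A f u ≢ weight A f v

numWeights : ∀ {N} → Adj N → Labeling N → ℕ
numWeights {N} A f = length (deduplicate ℕP._≟_ (map (weight A f) (allFin N)))

ChiLdEq : ∀ {N} → Adj N → ℕ → Set
ChiLdEq {N} A k =
  (∃ λ (f : Labeling N) → IsLDAL A f × numWeights A f ≡ k)
  × (∀ (f : Labeling N) → IsLDAL A f → k ≤ numWeights A f)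

Odd : ℕ → Set
Odd n = n % 2 ≡ 1

BipartiteEquiDegreeParts : ∀ {m} → Graph m → Set
BipartiteEquiDegreeParts {m} G =
  ∃ λ (side : Fin m → Bool) →
    (∀ u v → adj G u v ≡ true → side u ≢ side v)
    × (∀ u v → side u ≡ side v → deg G u ≡ deg G v)

NonRegular : ∀ {m} → Graph m → Set
NonRegular {m} G = ∃ λ (u : Fin m) → ∃ λ (v : Fin m) → deg G u ≢ deg G v

{-# OPTIONS --safe #-}
-- Label the vertex (g, h) of G[K̄ₙ] by 1 + h + n·σₕ(g), where σ₀, …, σₙ₋₁ are the rows
-- of a Kotzig array: permutations of {0, …, m − 1} whose column sums Σₕ σₕ(g) do not
-- depend on g. Then every fibre {g} × K̄ₙ carries the same label sum C, so the weight of
-- (g, h) is deg(g)·C. In a bipartite graph whose two parts are equi-degree with different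
-- degrees, adjacent vertices have different degrees and only two degrees occur, so this
-- labeling is local distance antimagic with two weights, while any edge forces two weights.
-- For odd m = 2k + 1 and odd n ≥ 3 the array consists of the three rows i, i + k and
-- 2k − 2i (mod m), of column sum 3k, together with (n − 3)/2 pairs of rows i, m − 1 − i.

module Submission where

open import Defs hiding (sym)
open import Data.Nat.Properties
  using ( +-*-semiring; +-assoc; +-comm; *-comm; +-identityʳ; ≤-pred; ≤-antisym; m≤m+n; m+[n∸m]≡n
        ; m≤n⇒∃[o]m+o≡n; ≰⇒>; +-cancelˡ-<; *-cancelʳ-≡)
open import Algebra.Properties.Semiring.Sum +-*-semiring
  using (sum-syntax; sum-cong-≗; ∑-distrib-+; *-distribˡ-sum; sum-replicate-zero)
open import Data.Bool using (Bool; true; false; if_then_else_; T?; _∨_)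
open import Data.Bool.Properties using (¬-not; ∨-identityʳ; ∧-zeroʳ)
import Data.Bool.Properties as Bool
open import Data.Empty using (⊥-elim)
open import Data.Fin using (Fin; zero; suc; toℕ; fromℕ<; opposite; combine; remQuot; quotient; remainder; _↑ˡ_; _↑ʳ_)
open import Data.Fin.Patterns using (0F; 1F; 2F)
open import Data.Fin.Permutation as Perm using (Permutation′; _⟨$⟩ʳ_; _⟨$⟩ˡ_; permutation; inverseˡ; inverseʳ)
open import Data.Fin.Properties
  using ( toℕ-injective; toℕ<n; toℕ≤pred[n]; toℕ-fromℕ<; toℕ-combine; remQuot-combine; combine-remQuot
        ; opposite-prop; splitAt-↑ˡ; splitAt-↑ʳ)
open import Data.List using (List; []; _∷_; length; map; filter; tabulate; allFin; deduplicate)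
open import Data.List.Membership.Propositional using (_∈_)
open import Data.List.Membership.Propositional.Properties using (∈-deduplicate⁺; ∈-map⁺; ∈-allFin)
open import Data.List.Properties using (map-tabulate)
open import Data.List.Relation.Unary.All as All using (All)
import Data.List.Relation.Unary.All.Properties as All
import Data.List.Relation.Unary.AllPairs as AllPairs
open import Data.List.Relation.Unary.Any using (here; there)
open import Data.List.Relation.Unary.Unique.Propositional using (Unique)
open import Data.Nat using (ℕ; zero; suc; pred; _+_; _*_; _%_; _/_; _≤_; _<_; _≟_; _≤?_; z≤n; s≤s; NonZero)
open import Data.Nat.DivMod using (m≡m%n+[m/n]*n; [m+kn]%n≡m%n; m<n⇒m%n≡m; m%n<n)
import Data.Nat.ListAction as List
open import Data.List.Relation.Unary.Unique.DecPropositional.Properties _≟_ using (deduplicate-!)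
open import Data.Nat.Tactic.RingSolver using (solve; solve-∀)
open import Data.Product using (∃; ∃₂; _,_; proj₁; uncurry)
open import Data.Sum using (_⊎_; inj₁; inj₂; [_,_]′)
import Data.Sum as Sum
open import Data.Vec.Functional using (_++_)
open import Function using (id; _∘_)
open import Relation.Binary.PropositionalEquality
  using (_≡_; _≢_; refl; sym; trans; cong; cong₂; subst; ≢-sym; module ≡-Reasoning)
open import Relation.Nullary using (yes; no)
open ≡-Reasoning

∑-tabulate : ∀ n (F : Fin n → ℕ) → List.sum (tabulate F) ≡ ∑[ i < n ] F i
∑-tabulate zero    F = refl
∑-tabulate (suc n) F = cong (F zero +_) (∑-tabulate n (F ∘ suc))

∑-allFin : ∀ n (F : Fin n → ℕ) → List.sum (map F (allFin n)) ≡ ∑[ i < n ] F i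
∑-allFin n F = trans (cong List.sum (map-tabulate id F)) (∑-tabulate n F)

∑-splitAt : ∀ a {b} (F : Fin (a + b) → ℕ) →
  ∑[ i < a + b ] F i ≡ ∑[ i < a ] F (i ↑ˡ b) + ∑[ j < b ] F (a ↑ʳ j)
∑-splitAt zero    F = refl
∑-splitAt (suc a) F = trans (cong (F zero +_) (∑-splitAt a (F ∘ suc))) (sym (+-assoc (F zero) _ _))

∑-combine : ∀ m {n} (F : Fin (m * n) → ℕ) →
  ∑[ x < m * n ] F x ≡ ∑[ g < m ] ∑[ h < n ] F (combine g h)
∑-combine zero        F = refl
∑-combine (suc m) {n} F =
  trans (∑-splitAt n F) (cong (∑[ h < n ] F (h ↑ˡ m * n) +_) (∑-combine m (F ∘ (n ↑ʳ_))))

∑-if : ∀ {n} b (F : Fin n → ℕ) → ∑[ i < n ] (if b then F i else 0) ≡ (if b then ∑[ i < n ] F i else 0)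
∑-if     true  F = refl
∑-if {n} false F = sum-replicate-zero n

sum-indicator : ∀ {A : Set} (P : A → Bool) c xs →
  List.sum (map (λ x → if P x then c else 0) xs) ≡ length (filter (T? ∘ P) xs) * c
sum-indicator P c []       = refl
sum-indicator P c (x ∷ xs) with P x
... | true  = cong (c +_) (sum-indicator P c xs)
... | false = sum-indicator P c xs

filter-nonEmpty : ∀ {A : Set} (P : A → Bool) xs → length (filter (T? ∘ P) xs) ≢ 0 → ∃ λ x → P x ≡ true
filter-nonEmpty P []       ≢0 = ⊥-elim (≢0 refl)
filter-nonEmpty P (x ∷ xs) ≢0 with P x in Px
... | true  = x , Px
... | false = filter-nonEmpty P xs ≢0

pigeonhole₂ : ∀ {A : Set} {a b x y z : A} →
  x ≡ a ⊎ x ≡ b → y ≡ a ⊎ y ≡ b → z ≡ a ⊎ z ≡ b → x ≡ y ⊎ x ≡ z ⊎ y ≡ z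
pigeonhole₂ (inj₁ refl) (inj₁ refl) _           = inj₁ refl
pigeonhole₂ (inj₂ refl) (inj₂ refl) _           = inj₁ refl
pigeonhole₂ (inj₁ refl) (inj₂ refl) (inj₁ refl) = inj₂ (inj₁ refl)
pigeonhole₂ (inj₂ refl) (inj₁ refl) (inj₂ refl) = inj₂ (inj₁ refl)
pigeonhole₂ (inj₁ refl) (inj₂ refl) (inj₂ refl) = inj₂ (inj₂ refl)
pigeonhole₂ (inj₂ refl) (inj₁ refl) (inj₁ refl) = inj₂ (inj₂ refl)

2≤length : ∀ {x y} {xs : List ℕ} → x ∈ xs → y ∈ xs → x ≢ y → 2 ≤ length xs
2≤length {xs = _ ∷ _ ∷ _} _          _          _   = s≤s (s≤s z≤n)
2≤length {xs = _ ∷ []}    (here refl) (here refl) x≢y = ⊥-elim (x≢y refl)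
2≤length {xs = _ ∷ []}    (there ())  _           _
2≤length {xs = _ ∷ []}    _           (there ())  _

length≤2 : ∀ {a b} {xs : List ℕ} → Unique xs → All (λ x → x ≡ a ⊎ x ≡ b) xs → length xs ≤ 2
length≤2 {xs = []}              _ _ = z≤n
length≤2 {xs = _ ∷ []}          _ _ = s≤s z≤n
length≤2 {xs = _ ∷ _ ∷ []}      _ _ = s≤s (s≤s z≤n)
length≤2 {xs = _ ∷ _ ∷ _ ∷ _}
  ((x≢y All.∷ x≢z All.∷ _) AllPairs.∷ (y≢z All.∷ _) AllPairs.∷ _) (x∈ All.∷ y∈ All.∷ z∈ All.∷ _) =
  ⊥-elim ([ x≢y , [ x≢z , y≢z ]′ ]′ (pigeonhole₂ x∈ y∈ z∈))

module _ {N} {A : Adj N} where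

  2≤numWeights : ∀ (f : Labeling N) {u v} → weight A f u ≢ weight A f v → 2 ≤ numWeights A f
  2≤numWeights f {u} {v} = 2≤length (∈-weights u) (∈-weights v)
    where
    ∈-weights : ∀ x → weight A f x ∈ deduplicate _≟_ (map (weight A f) (allFin N))
    ∈-weights x = ∈-deduplicate⁺ _≟_ (∈-map⁺ (weight A f) (∈-allFin x))

  numWeights≤2 : ∀ (f : Labeling N) {a b} → (∀ u → weight A f u ≡ a ⊎ weight A f u ≡ b) → numWeights A f ≤ 2
  numWeights≤2 f twoValues =
    length≤2 (deduplicate-! _) (All.deduplicate⁺ _≟_ (All.map⁺ (All.tabulate⁺ twoValues)))

  χld≡2 : ∀ (f : Labeling N) → IsLDAL A f →
    (∃₂ λ a b → ∀ u → weight A f u ≡ a ⊎ weight A f u ≡ b) → (∃₂ λ u v → A u v ≡ true) → ChiLdEq A 2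
  χld≡2 f ldal (_ , _ , twoValues) (u , v , uv) =
    (f , ldal , ≤-antisym (numWeights≤2 f twoValues) (atLeastTwo f ldal)) , atLeastTwo
    where
    atLeastTwo : ∀ g → IsLDAL A g → 2 ≤ numWeights A g
    atLeastTwo g ldal-g = 2≤numWeights g (ldal-g u v uv)

quotient-combine : ∀ {m n} (g : Fin m) (h : Fin n) → quotient n (combine g h) ≡ g
quotient-combine g h = cong proj₁ (remQuot-combine g h)

lexAdj-emptyGraph : ∀ {m n} (G : Graph m) u v → lexAdj G (emptyGraph n) u v ≡ adj G (quotient n u) (quotient n v)
lexAdj-emptyGraph G u v = trans (cong (adj G _ _ ∨_) (∧-zeroʳ _)) (∨-identityʳ _)

lexAdj-combine : ∀ {m n} (G : Graph m) {g g′} → adj G g g′ ≡ true → (h : Fin n) →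
  lexAdj G (emptyGraph n) (combine g h) (combine g′ h) ≡ true
lexAdj-combine G {g} {g′} gg′ h =
  trans (lexAdj-emptyGraph G _ _) (trans (cong₂ (adj G) (quotient-combine g h) (quotient-combine g′ h)) gg′)

module _ {m n} (G : Graph m) (f : Labeling (m * n)) {C}
         (fiberSum : ∀ (g : Fin m) → ∑[ h < n ] label f (combine g h) ≡ C) where

  weight-lex : ∀ u → weight (lexAdj G (emptyGraph n)) f u ≡ deg G (quotient n u) * C
  weight-lex u = begin
    weight (lexAdj G (emptyGraph n)) f u                  ≡⟨ ∑-allFin (m * n) W ⟩
    ∑[ x < m * n ] W x                                    ≡⟨ ∑-combine m W ⟩
    ∑[ g < m ] ∑[ h < n ] W (combine g h)                 ≡⟨ sum-cong-≗ fiberWeight ⟩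
    ∑[ g < m ] (if adj G g₀ g then C else 0)              ≡⟨ ∑-allFin m _ ⟨
    List.sum (map (λ g → if adj G g₀ g then C else 0) (allFin m)) ≡⟨ sum-indicator (adj G g₀) C (allFin m) ⟩
    deg G g₀ * C                                          ∎
    where
    g₀ : Fin m
    g₀ = quotient n u
    W : Fin (m * n) → ℕ
    W x = if lexAdj G (emptyGraph n) u x then label f x else 0
    fiberWeight : ∀ g → ∑[ h < n ] W (combine g h) ≡ (if adj G g₀ g then C else 0)
    fiberWeight g = begin
      ∑[ h < n ] W (combine g h)                                  ≡⟨ sum-cong-≗ W-combine ⟩
      ∑[ h < n ] (if adj G g₀ g then label f (combine g h) else 0) ≡⟨ ∑-if (adj G g₀ g) (label f ∘ combine g) ⟩
      (if adj G g₀ g then ∑[ h < n ] label f (combine g h) else 0) ≡⟨ cong (λ s → if adj G g₀ g then s else 0) (fiberSum g) ⟩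
      (if adj G g₀ g then C else 0)                                ∎
      where
      W-combine : ∀ h → W (combine g h) ≡ (if adj G g₀ g then label f (combine g h) else 0)
      W-combine h = cong (λ b → if b then label f (combine g h) else 0)
        (trans (lexAdj-emptyGraph G u _) (cong (adj G g₀) (quotient-combine g h)))

  isLDAL-lex : .{{_ : NonZero C}} → (∀ g g′ → adj G g g′ ≡ true → deg G g ≢ deg G g′) →
    IsLDAL (lexAdj G (emptyGraph n)) f
  isLDAL-lex deg≢ u v uv w≡ =
    deg≢ _ _ (trans (sym (lexAdj-emptyGraph G u v)) uv)
      (*-cancelʳ-≡ _ _ C (trans (sym (weight-lex u)) (trans w≡ (weight-lex v))))

[m*[n%d]+o]%d≡[m*n+o]%d : ∀ m n o d .{{_ : NonZero d}} → (m * (n % d) + o) % d ≡ (m * n + o) % d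
[m*[n%d]+o]%d≡[m*n+o]%d m n o d = begin
  (m * (n % d) + o) % d                   ≡⟨ [m+kn]%n≡m%n _ (m * (n / d)) d ⟨
  (m * (n % d) + o + m * (n / d) * d) % d ≡⟨ cong (_% d) (regroup m (n % d) (n / d) d o) ⟩
  (m * (n % d + n / d * d) + o) % d       ≡⟨ cong (λ n′ → (m * n′ + o) % d) (m≡m%n+[m/n]*n n d) ⟨
  (m * n + o) % d                         ∎
  where
  regroup : ∀ m r q d o → m * r + o + m * q * d ≡ m * (r + q * d) + o
  regroup = solve-∀

remainder-unique : ∀ m n .{{_ : NonZero n}} r q g → n ≡ suc (r + g) → m ≡ r + q * n → m % n ≡ r
remainder-unique _ _ r q g refl refl = trans ([m+kn]%n≡m%n r q _) (m<n⇒m%n≡m (s≤s (m≤m+n r g)))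

affine : ∀ M .{{_ : NonZero M}} → ℕ → ℕ → Fin M → Fin M
affine M a b i = fromℕ< (m%n<n (a * toℕ i + b) M)

toℕ-affine : ∀ M .{{_ : NonZero M}} a b i → toℕ (affine M a b i) ≡ (a * toℕ i + b) % M
toℕ-affine M a b i = toℕ-fromℕ< _

affine-inverse : ∀ {M} .{{_ : NonZero M}} a b c d x y → a * c ≡ 1 + x * M → a * d + b ≡ y * M →
  ∀ i → affine M a b (affine M c d i) ≡ i
affine-inverse {M} a b c d x y ac≡1 ad+b≡0 i = toℕ-injective (begin
  toℕ (affine M a b (affine M c d i))  ≡⟨ toℕ-affine M a b (affine M c d i) ⟩
  (a * toℕ (affine M c d i) + b) % M   ≡⟨ cong (λ z → (a * z + b) % M) (toℕ-affine M c d i) ⟩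
  (a * ((c * j + d) % M) + b) % M      ≡⟨ [m*[n%d]+o]%d≡[m*n+o]%d a (c * j + d) b M ⟩
  (a * (c * j + d) + b) % M            ≡⟨ cong (_% M) expand ⟩
  (j + (x * j + y) * M) % M            ≡⟨ [m+kn]%n≡m%n j (x * j + y) M ⟩
  j % M                                ≡⟨ m<n⇒m%n≡m (toℕ<n i) ⟩
  j                                    ∎)
  where
  j : ℕ
  j = toℕ i
  expand : a * (c * j + d) + b ≡ j + (x * j + y) * M
  expand = begin
    a * (c * j + d) + b       ≡⟨ distribute a b c d j ⟩
    a * c * j + (a * d + b)   ≡⟨ cong₂ (λ p q → p * j + q) ac≡1 ad+b≡0 ⟩
    (1 + x * M) * j + y * M   ≡⟨ collect x y j M ⟩
    j + (x * j + y) * M       ∎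
    where
    distribute : ∀ a b c d j → a * (c * j + d) + b ≡ a * c * j + (a * d + b)
    distribute = solve-∀
    collect : ∀ x y j M → (1 + x * M) * j + y * M ≡ j + (x * j + y) * M
    collect = solve-∀

-- The hypotheses are the congruences ac ≡ 1, ad + b ≡ 0 and cb + d ≡ 0 (mod M),
-- stated in ℕ with explicit quotients.
affinePermutation : ∀ M .{{_ : NonZero M}} a b c d x y y′ →
  a * c ≡ 1 + x * M → a * d + b ≡ y * M → c * b + d ≡ y′ * M → Permutation′ M
affinePermutation M a b c d x y y′ ac≡1 ad+b≡0 cb+d≡0 =
  permutation (affine M a b) (affine M c d)
    (affine-inverse a b c d x y ac≡1 ad+b≡0)
    (affine-inverse c d a b x y′ (trans (*-comm c a) ac≡1) cb+d≡0)

record KotzigArray (r m : ℕ) : Set where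
  field
    row                : Fin r → Permutation′ m
    columnSum          : ℕ
    columnSum-constant : ∀ i → ∑[ j < r ] toℕ (row j ⟨$⟩ʳ i) ≡ columnSum
open KotzigArray

kotzig-++ : ∀ {a b m} → KotzigArray a m → KotzigArray b m → KotzigArray (a + b) m
kotzig-++ {a} {b} {m} K L = record
  { row                = rows
  ; columnSum          = columnSum K + columnSum L
  ; columnSum-constant = constant
  }
  where
  rows : Fin (a + b) → Permutation′ m
  rows = row K ++ row L
  constant : ∀ i → ∑[ j < a + b ] toℕ (rows j ⟨$⟩ʳ i) ≡ columnSum K + columnSum L
  constant i = begin
    ∑[ j < a + b ] toℕ (rows j ⟨$⟩ʳ i)
      ≡⟨ ∑-splitAt a (λ j → toℕ (rows j ⟨$⟩ʳ i)) ⟩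
    ∑[ j < a ] toℕ (rows (j ↑ˡ b) ⟨$⟩ʳ i) + ∑[ j < b ] toℕ (rows (a ↑ʳ j) ⟨$⟩ʳ i)
      ≡⟨ cong₂ _+_ (sum-cong-≗ (λ j → cong (entry ∘ [ row K , row L ]′) (splitAt-↑ˡ a j b)))
                   (sum-cong-≗ (λ j → cong (entry ∘ [ row K , row L ]′) (splitAt-↑ʳ a b j))) ⟩
    ∑[ j < a ] toℕ (row K j ⟨$⟩ʳ i) + ∑[ j < b ] toℕ (row L j ⟨$⟩ʳ i)
      ≡⟨ cong₂ _+_ (columnSum-constant K i) (columnSum-constant L i) ⟩
    columnSum K + columnSum L
      ∎
    where
    entry : Permutation′ m → ℕ
    entry π = toℕ (π ⟨$⟩ʳ i)

toℕ+toℕ-opposite : ∀ {m} (i : Fin m) → toℕ i + toℕ (opposite i) ≡ pred m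
toℕ+toℕ-opposite {suc m} i = trans (cong (toℕ i +_) (opposite-prop i)) (m+[n∸m]≡n (toℕ≤pred[n] i))

kotzig₂ : ∀ m → KotzigArray 2 m
kotzig₂ m = record
  { row                = λ { 0F → Perm.id ; 1F → Perm.reverse }
  ; columnSum          = pred m
  ; columnSum-constant = λ i → trans (cong (toℕ i +_) (+-identityʳ _)) (toℕ+toℕ-opposite i)
  }

data Halves : ℕ → ℕ → Set where
  lower : ∀ i d → Halves (i + d) i
  upper : ∀ e f → Halves (suc (e + f)) (suc (suc (e + f) + e))

halves : ∀ k i → i < suc (k + k) → Halves k i
halves k i i<2k+1 with i ≤? k
... | yes i≤k with d , refl ← m≤n⇒∃[o]m+o≡n i≤k = lower i d
... | no i≰k with e , refl ← m≤n⇒∃[o]m+o≡n (≰⇒> i≰k)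
             with f , refl ← m≤n⇒∃[o]m+o≡n (+-cancelˡ-< k e k (≤-pred i<2k+1)) = upper e f

kotzig₃-columnSum : ∀ k i → i < suc (k + k) →
  i + ((1 * i + k) % suc (k + k) + ((suc (k * 6) * i + k * 2) % suc (k + k) + 0)) ≡ k * 3
kotzig₃-columnSum k i i<2k+1 with halves k i i<2k+1
... | lower i d = trans (cong₂ (λ p q → i + (p + (q + 0))) row₁ row₂) (solve (i ∷ d ∷ []))
  where
  row₁ : (1 * i + (i + d)) % suc (i + d + (i + d)) ≡ i + (i + d)
  row₁ = remainder-unique (1 * i + (i + d)) (suc (i + d + (i + d))) (i + (i + d)) 0 d
    (solve (i ∷ d ∷ [])) (solve (i ∷ d ∷ []))
  row₂ : (suc ((i + d) * 6) * i + (i + d) * 2) % suc (i + d + (i + d)) ≡ d + d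
  row₂ = remainder-unique (suc ((i + d) * 6) * i + (i + d) * 2) (suc (i + d + (i + d))) (d + d) (i * 3) (i + i)
    (solve (i ∷ d ∷ [])) (solve (i ∷ d ∷ []))
... | upper e f = trans (cong₂ (λ p q → suc (suc (e + f) + e) + (p + (q + 0))) row₁ row₂) (solve (e ∷ f ∷ []))
  where
  row₁ : (1 * suc (suc (e + f) + e) + suc (e + f)) % suc (suc (e + f) + suc (e + f)) ≡ e
  row₁ = remainder-unique (1 * suc (suc (e + f) + e) + suc (e + f)) (suc (suc (e + f) + suc (e + f)))
    e 1 (suc (suc (e + f + f))) (solve (e ∷ f ∷ [])) (solve (e ∷ f ∷ []))
  row₂ : (suc (suc (e + f) * 6) * suc (suc (e + f) + e) + suc (e + f) * 2) % suc (suc (e + f) + suc (e + f))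
         ≡ suc (f + f)
  row₂ = remainder-unique (suc (suc (e + f) * 6) * suc (suc (e + f) + e) + suc (e + f) * 2)
    (suc (suc (e + f) + suc (e + f))) (suc (f + f)) (e * 6 + f * 3 + 5) (e + e + 1)
    (solve (e ∷ f ∷ [])) (solve (e ∷ f ∷ []))

-- The third row is i ↦ 2k − 2i (mod 2k + 1), written with the multiplier 6k + 1 ≡ −2,
-- whose inverse 3k + 1 has a natural-number quotient even for k = 0.
kotzig₃ : ∀ k → KotzigArray 3 (suc (k + k))
kotzig₃ k = record
  { row                = λ { 0F → Perm.id ; 1F → rotation ; 2F → affineRow }
  ; columnSum          = k * 3
  ; columnSum-constant = λ i →
      trans (cong₂ (λ p q → toℕ i + (p + (q + 0)))
                   (toℕ-affine (suc (k + k)) 1 k i) (toℕ-affine (suc (k + k)) (suc (k * 6)) (k * 2) i))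
            (kotzig₃-columnSum k (toℕ i) (toℕ<n i))
  }
  where
  rotation affineRow : Permutation′ (suc (k + k))
  rotation  = affinePermutation (suc (k + k)) 1 k 1 (suc k) 0 1 1 refl (solve (k ∷ [])) (solve (k ∷ []))
  affineRow = affinePermutation (suc (k + k)) (suc (k * 6)) (k * 2) (suc (k * 3)) k (k * 9) (k * 3) (k * 3)
    (solve (k ∷ [])) (solve (k ∷ [])) (solve (k ∷ []))

odd⇒≡1+2k : ∀ {m} → Odd m → m ≡ suc (m / 2 + m / 2)
odd⇒≡1+2k {m} odd = trans (m≡m%n+[m/n]*n m 2) (cong₂ _+_ odd (double (m / 2)))
  where
  double : ∀ k → k * 2 ≡ k + k
  double = solve-∀

kotzigArray : ∀ n {m} → 3 ≤ n → Odd n → Odd m → KotzigArray n m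
kotzigArray 3 {m} _ _ odd-m = subst (KotzigArray 3) (sym (odd⇒≡1+2k odd-m)) (kotzig₃ (m / 2))
kotzigArray 1 (s≤s ()) _ _
kotzigArray 4 _ () _
kotzigArray (suc (suc n@(suc (suc (suc _))))) _ odd-n odd-m =
  kotzig-++ (kotzig₂ _) (kotzigArray n (s≤s (s≤s (s≤s z≤n))) odd-n odd-m)

module _ {m n : ℕ} where

  columnMap : (Fin n → Fin m → Fin m) → Fin (m * n) → Fin (m * n)
  columnMap φ = uncurry (λ g h → combine (φ h g) h) ∘ remQuot n

  columnMap-combine : ∀ φ g h → columnMap φ (combine g h) ≡ combine (φ h g) h
  columnMap-combine φ g h = cong (uncurry (λ g h → combine (φ h g) h)) (remQuot-combine g h)

  columnMap-inverse : ∀ {φ ψ} → (∀ h g → φ h (ψ h g) ≡ g) → ∀ x → columnMap φ (columnMap ψ x) ≡ x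
  columnMap-inverse {φ} {ψ} φψ x = begin
    columnMap φ (combine (ψ h g) h) ≡⟨ columnMap-combine φ (ψ h g) h ⟩
    combine (φ h (ψ h g)) h         ≡⟨ cong (λ g′ → combine g′ h) (φψ h g) ⟩
    combine g h                     ≡⟨ combine-remQuot {m} n x ⟩
    x                               ∎
    where
    g : Fin m
    g = quotient n x
    h : Fin n
    h = remainder {m} n x

  columnwise : (Fin n → Permutation′ m) → Labeling (m * n)
  columnwise σ = permutation (columnMap (λ h → σ h ⟨$⟩ʳ_)) (columnMap (λ h → σ h ⟨$⟩ˡ_))
    (columnMap-inverse {φ = λ h → σ h ⟨$⟩ʳ_} (λ h _ → inverseʳ (σ h)))
    (columnMap-inverse {φ = λ h → σ h ⟨$⟩ˡ_} (λ h _ → inverseˡ (σ h)))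

  fiberSum-columnwise : ∀ (K : KotzigArray n m) g →
    ∑[ h < n ] label (columnwise (row K)) (combine g h) ≡ ∑[ h < n ] suc (toℕ h) + n * columnSum K
  fiberSum-columnwise K g = begin
    ∑[ h < n ] label (columnwise (row K)) (combine g h)                 ≡⟨ sum-cong-≗ label-combine ⟩
    ∑[ h < n ] (suc (toℕ h) + n * σ h)                                 ≡⟨ ∑-distrib-+ (suc ∘ toℕ) ((n *_) ∘ σ) ⟩
    ∑[ h < n ] suc (toℕ h) + ∑[ h < n ] (n * σ h)                     ≡⟨ cong (_ +_) (*-distribˡ-sum n σ) ⟨
    ∑[ h < n ] suc (toℕ h) + n * ∑[ h < n ] σ h                       ≡⟨ cong (λ s → _ + n * s) (columnSum-constant K g) ⟩
    ∑[ h < n ] suc (toℕ h) + n * columnSum K                          ∎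
    where
    σ : Fin n → ℕ
    σ h = toℕ (row K h ⟨$⟩ʳ g)
    label-combine : ∀ h → label (columnwise (row K)) (combine g h) ≡ suc (toℕ h) + n * σ h
    label-combine h = cong suc (begin
      toℕ (columnMap (λ h → row K h ⟨$⟩ʳ_) (combine g h)) ≡⟨ cong toℕ (columnMap-combine (λ h → row K h ⟨$⟩ʳ_) g h) ⟩
      toℕ (combine (row K h ⟨$⟩ʳ g) h)                    ≡⟨ toℕ-combine _ h ⟩
      n * σ h + toℕ h                                     ≡⟨ +-comm _ (toℕ h) ⟩
      toℕ h + n * σ h                                     ∎)

≢-≢⇒≡ : ∀ {x y z : Bool} → x ≢ y → x ≢ z → y ≡ z
≢-≢⇒≡ x≢y x≢z = trans (¬-not (≢-sym x≢y)) (sym (¬-not (≢-sym x≢z)))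

module EquiDegreeParts {m} (G : Graph m) (side : Fin m → Bool)
  (equi : ∀ u v → side u ≡ side v → deg G u ≡ deg G v) {a b : Fin m} (a≉b : deg G a ≢ deg G b) where

  private
    a≁b : side a ≢ side b
    a≁b = a≉b ∘ equi a b

    across : ∀ {u v} → side u ≡ side a → side v ≡ side b → deg G u ≢ deg G v
    across {u} {v} ua vb uv = a≉b (trans (sym (equi u a ua)) (trans uv (equi v b vb)))

  deg-either : ∀ u → deg G u ≡ deg G a ⊎ deg G u ≡ deg G b
  deg-either u with side u Bool.≟ side a
  ... | yes ua  = inj₁ (equi u a ua)
  ... | no  u≁a = inj₂ (equi u b (≢-≢⇒≡ (u≁a ∘ sym) a≁b))

  deg≢-across : ∀ u v → side u ≢ side v → deg G u ≢ deg G v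
  deg≢-across u v u≁v with side u Bool.≟ side a
  ... | yes ua  = across ua (≢-≢⇒≡ (u≁v ∘ trans ua) a≁b)
  ... | no  u≁a = across (≢-≢⇒≡ u≁v u≁a) (≢-≢⇒≡ (u≁a ∘ sym) a≁b) ∘ sym

nonRegular⇒edge : ∀ {m} (G : Graph m) → NonRegular G → ∃₂ λ u v → adj G u v ≡ true
nonRegular⇒edge G (a , b , a≉b) with deg G a ≟ 0
... | yes a≡0 = b , filter-nonEmpty (adj G b) (allFin _) (λ b≡0 → a≉b (trans a≡0 (sym b≡0)))
... | no  a≢0 = a , filter-nonEmpty (adj G a) (allFin _) a≢0

mainTheorem8 : (n m : ℕ) → 3 ≤ n → Odd n → 1 < m → Odd m
    → (G : Graph m) → NonRegular G → BipartiteEquiDegreeParts G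
    → ChiLdEq (lexAdj G (emptyGraph n)) 2
mainTheorem8 zero _ () _ _ _ _ _ _
mainTheorem8 n@(suc _) m 3≤n odd-n _ odd-m G nonRegular@(a , b , a≉b) (side , proper , equi) =
  χld≡2 f isLDAL (deg G a * C , deg G b * C , twoWeights) edge
  where
  open EquiDegreeParts G side equi a≉b

  A : Adj (m * n)
  A = lexAdj G (emptyGraph n)

  K : KotzigArray n m
  K = kotzigArray n 3≤n odd-n odd-m

  f : Labeling (m * n)
  f = columnwise (row K)

  C : ℕ
  C = ∑[ h < n ] suc (toℕ h) + n * columnSum K

  fiberSum : ∀ g → ∑[ h < n ] label f (combine g h) ≡ C
  fiberSum = fiberSum-columnwise K

  isLDAL : IsLDAL A f
  isLDAL = isLDAL-lex G f fiberSum (λ u v uv → deg≢-across u v (proper u v uv))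

  twoWeights : ∀ u → weight A f u ≡ deg G a * C ⊎ weight A f u ≡ deg G b * C
  twoWeights u = Sum.map weight≡ weight≡ (deg-either (quotient n u))
    where
    weight≡ : ∀ {d} → deg G (quotient n u) ≡ d → weight A f u ≡ d * C
    weight≡ d≡ = trans (weight-lex G f fiberSum u) (cong (_* C) d≡)

  edge : ∃₂ λ x y → A x y ≡ true
  edge with x , y , xy ← nonRegular⇒edge G nonRegular = combine x zero , combine y zero , lexAdj-combine G xy zero
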